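{- Let $V$ be a vector space of finite dimension $r$ over $\mathbb{F}_q$ and let $A\subseteq V$ be an $S_h$-linear set with $2h<r\leq|A|$. Then $A$ is an $S_j$-linear set for every $1\leq j\leq h-1$.
   Context: For a non-empty subset $A$ of $V$ and a positive integer $h\leq|A|$, an $h$-linear combination of $A$ is an expression $\lambda_1\boldsymbol{a}_1+\cdots+\lambda_h\boldsymbol{a}_h$ with $\lambda_i\in\mathbb{F}_q^*$ and $\boldsymbol{a}_1,\dots,\boldsymbol{a}_h$ distinct elements of $A$. $A$ is an $S_h$-linear set if all $h$-linear combinations of elements of $A$, omitting permutations of the summands, yield distinct elements of $V$. -}

module Defs where

open import Level using (Level; _⊔_)
open import Data.Nat using (ℕ; zero; suc)
open import Data.Fin using (Fin; zero; suc)
open import Data.Product using (Σ; ∃; _×_; _,_)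
open import Relation.Nullary using (¬_)
open import Relation.Binary.PropositionalEquality using (_≡_)
open import Algebra.Bundles using (CommutativeRing)
open import Data.Fin.Permutation using (Permutation′; _⟨$⟩ʳ_)

record FiniteField (c ℓ : Level) : Set (Level.suc (c ⊔ ℓ)) where
  field
    commRing : CommutativeRing c ℓ
  open CommutativeRing commRing public
  field
    0≉1     : ¬ (0# ≈ 1#)
    inverse : ∀ x → ¬ (x ≈ 0#) → ∃ λ y → (x * y) ≈ 1#
    q       : ℕ
    enum    : Fin q → Carrier
    enum-injective  : ∀ i j → enum i ≈ enum j → i ≡ j
    enum-surjective : ∀ x → ∃ λ i → enum i ≈ x

module _ {c ℓ : Level} (F : FiniteField c ℓ) where
  open FiniteField F using (Carrier; _≈_; _+_; _*_; 0#)

  Vect : ℕ → Set c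
  Vect r = Fin r → Carrier

  _≈ᵥ_ : ∀ {r} → Vect r → Vect r → Set ℓ
  u ≈ᵥ v = ∀ k → u k ≈ v k

  _+ᵥ_ : ∀ {r} → Vect r → Vect r → Vect r
  (u +ᵥ v) k = u k + v k

  _·ᵥ_ : ∀ {r} → Carrier → Vect r → Vect r
  (x ·ᵥ v) k = x * v k

  0ᵥ : ∀ {r} → Vect r
  0ᵥ k = 0#

  sumᵥ : ∀ {r} h → (Fin h → Vect r) → Vect r
  sumᵥ zero    f = 0ᵥ
  sumᵥ (suc h) f = f zero +ᵥ sumᵥ h (λ i → f (suc i))

  -- The set A ⊆ V with |A| = n is given by an injective enumeration
  -- a : Fin n → V.  An h-linear combination of A is given by an injective
  -- choice s : Fin h → Fin n of h distinct elements and nonzero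
  -- coefficients λ : Fin h → 𝔽_q*; its value is Σ λᵢ a_{s i}.
  linComb : ∀ {r n h} → (Fin n → Vect r) → (Fin h → Fin n) → (Fin h → Carrier) → Vect r
  linComb {h = h} a s λs = sumᵥ h (λ i → λs i ·ᵥ a (s i))

  InjectiveFin : ∀ {m n} → (Fin m → Fin n) → Set
  InjectiveFin s = ∀ i j → s i ≡ s j → i ≡ j

  InjectiveV : ∀ {r n} → (Fin n → Vect r) → Set ℓ
  InjectiveV a = ∀ i j → a i ≈ᵥ a j → i ≡ j

  IsSLinear : ∀ {r n} → ℕ → (Fin n → Vect r) → Set (c ⊔ ℓ)
  IsSLinear {r} {n} h a =
    ∀ (s s' : Fin h → Fin n) (λs λs' : Fin h → Carrier) →
    InjectiveFin s → InjectiveFin s' →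
    (∀ i → ¬ (λs i ≈ 0#)) → (∀ i → ¬ (λs' i ≈ 0#)) →
    linComb a s λs ≈ᵥ linComb a s' λs' →
    Σ (Permutation′ h) λ π → ∀ i → (s' (π ⟨$⟩ʳ i) ≡ s i) × (λs' (π ⟨$⟩ʳ i) ≈ λs i)

-- Given two j-linear combinations of A with equal values, 2j < |A| leaves an
-- element x of A used by neither.  Adding x with coefficient 1 to both gives
-- two equal (j+1)-linear combinations, which by S_{j+1}-linearity agree up to
-- a permutation; that permutation must match x with itself, and removing x
-- leaves the permutation identifying the original two.  Hence S_{j+1} ⇒ S_j
-- whenever 2j < |A|, and descending from h gives every j ≤ h.
module Submission where

open import Defs
open import Level using (Level)
open import Data.Nat using (ℕ; _≤_; _<_; _*_; _∸_; suc; _+_; _≤′_; ≤′-refl; ≤′-step)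
open import Data.Nat.Properties
  using (≤-trans; <-≤-trans; <⇒≤; ≤⇒≤′; +-mono-<-≤; n<1+n; n≤1+n; m∸n≤m; +-identityʳ; ≤⇒≯)
open import Data.Fin using (Fin; zero; suc; splitAt; _↑ˡ_; _↑ʳ_; punchIn)
open import Data.Fin.Properties using (any?; _≟_; ¬∀⟶∃¬; injective⇒≤; splitAt-↑ˡ; splitAt-↑ʳ)
open import Data.Fin.Permutation using (Permutation′; _⟨$⟩ʳ_; remove; punchIn-permute)
open import Data.Vec.Functional using (_∷_)
open import Data.Product using (Σ; ∃; _×_; _,_; proj₁; proj₂)
open import Data.Sum using ([_,_])
open import Relation.Nullary using (¬_; contradiction)
open import Relation.Binary.PropositionalEquality
  using (_≡_; _≢_; refl; sym; trans; cong; subst)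

∃-notInImage : ∀ {m n} → m < n → (g : Fin m → Fin n) → ∃ λ x → ∀ k → g k ≢ x
∃-notInImage {m} {n} m<n g with ¬∀⟶∃¬ n _ (λ x → any? (λ k → g k ≟ x)) g-nonsurjective
  where
  g-nonsurjective : ¬ (∀ x → ∃ λ k → g k ≡ x)
  g-nonsurjective surj = ≤⇒≯ (injective⇒≤ section-injective) m<n
    where
    section-injective : ∀ {x y} → proj₁ (surj x) ≡ proj₁ (surj y) → x ≡ y
    section-injective {x} {y} eq =
      trans (sym (proj₂ (surj x))) (trans (cong g eq) (proj₂ (surj y)))
... | x , x∉img = x , λ k gk≡x → x∉img (k , gk≡x)

∃-notInImages : ∀ {m m′ n} → m + m′ < n → (s : Fin m → Fin n) (s′ : Fin m′ → Fin n) →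
  ∃ λ x → (∀ i → s i ≢ x) × (∀ i → s′ i ≢ x)
∃-notInImages {m} {m′} lt s s′ with ∃-notInImage lt (λ k → [ s , s′ ] (splitAt m k))
... | x , x∉img =
  x , (λ i → subst (_≢ x) (cong [ s , s′ ] (splitAt-↑ˡ m i m′)) (x∉img (i ↑ˡ m′)))
    , (λ i → subst (_≢ x) (cong [ s , s′ ] (splitAt-↑ʳ m m′ i)) (x∉img (m ↑ʳ i)))

∷-injective : ∀ {m n} {x : Fin n} {t : Fin m → Fin n} →
  (∀ i → t i ≢ x) → (∀ i j → t i ≡ t j → i ≡ j) →
  ∀ i j → (x ∷ t) i ≡ (x ∷ t) j → i ≡ j
∷-injective x∉t t-inj zero    zero    _  = refl
∷-injective x∉t t-inj zero    (suc j) eq = contradiction (sym eq) (x∉t j)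
∷-injective x∉t t-inj (suc i) zero    eq = contradiction eq (x∉t i)
∷-injective x∉t t-inj (suc i) (suc j) eq = cong suc (t-inj i j eq)

∷-preimage-head : ∀ {m n} {x : Fin n} {t : Fin m → Fin n} →
  (∀ i → t i ≢ x) → ∀ i → (x ∷ t) i ≡ x → i ≡ zero
∷-preimage-head x∉t zero    _  = refl
∷-preimage-head x∉t (suc i) eq = contradiction eq (x∉t i)

remove-zero-commutes : ∀ {m} (π : Permutation′ (suc m)) → π ⟨$⟩ʳ zero ≡ zero →
  ∀ i → π ⟨$⟩ʳ suc i ≡ suc (remove zero π ⟨$⟩ʳ i)
remove-zero-commutes π π0≡0 i =
  trans (punchIn-permute π zero i) (cong (λ z → punchIn z (remove zero π ⟨$⟩ʳ i)) π0≡0)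

module _ {c ℓ : Level} (F : FiniteField c ℓ) {r n : ℕ} (a : Fin n → Vect F r) where
  open FiniteField F using (Carrier; _≈_; 0#; 1#; 0≉1; +-cong)
    renaming (refl to ≈-refl; sym to ≈-sym)

  ∷-nonzero : ∀ {m y} {t : Fin m → Carrier} →
    ¬ y ≈ 0# → (∀ i → ¬ t i ≈ 0#) → ∀ i → ¬ (y ∷ t) i ≈ 0#
  ∷-nonzero y≉0 t≉0 zero    = y≉0
  ∷-nonzero y≉0 t≉0 (suc i) = t≉0 i

  IsSLinear-pred : ∀ j → j + j < n → IsSLinear F (suc j) a → IsSLinear F j a
  IsSLinear-pred j 2j<n S s s′ λs λs′ s-inj s′-inj λs≉0 λs′≉0 eq = remove zero π , matching
    where
    x : Fin n
    x = proj₁ (∃-notInImages 2j<n s s′)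

    x∉s : ∀ i → s i ≢ x
    x∉s = proj₁ (proj₂ (∃-notInImages 2j<n s s′))

    x∉s′ : ∀ i → s′ i ≢ x
    x∉s′ = proj₂ (proj₂ (∃-notInImages 2j<n s s′))

    1≉0 : ¬ 1# ≈ 0#
    1≉0 1≈0 = 0≉1 (≈-sym 1≈0)

    extended : Σ (Permutation′ (suc j)) λ π →
      ∀ i → ((x ∷ s′) (π ⟨$⟩ʳ i) ≡ (x ∷ s) i) × ((1# ∷ λs′) (π ⟨$⟩ʳ i) ≈ (1# ∷ λs) i)
    extended = S (x ∷ s) (x ∷ s′) (1# ∷ λs) (1# ∷ λs′)
      (∷-injective x∉s s-inj) (∷-injective x∉s′ s′-inj)
      (∷-nonzero 1≉0 λs≉0) (∷-nonzero 1≉0 λs′≉0)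
      (λ k → +-cong ≈-refl (eq k))

    π : Permutation′ (suc j)
    π = proj₁ extended

    π0≡0 : π ⟨$⟩ʳ zero ≡ zero
    π0≡0 = ∷-preimage-head x∉s′ (π ⟨$⟩ʳ zero) (proj₁ (proj₂ extended zero))

    matching : ∀ i → (s′ (remove zero π ⟨$⟩ʳ i) ≡ s i) × (λs′ (remove zero π ⟨$⟩ʳ i) ≈ λs i)
    matching i = subst (λ z → ((x ∷ s′) z ≡ s i) × ((1# ∷ λs′) z ≈ λs i))
      (remove-zero-commutes π π0≡0 i) (proj₂ extended (suc i))

  IsSLinear-downward : ∀ {j h} → j ≤′ h → h + h ≤ n → IsSLinear F h a → IsSLinear F j a
  IsSLinear-downward ≤′-refl _ S = S
  IsSLinear-downward {h = suc h} (≤′-step j≤′h) 2h+2≤n S =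
    IsSLinear-downward j≤′h (<⇒≤ 2h<n) (IsSLinear-pred h 2h<n S)
    where
    2h<n : h + h < n
    2h<n = <-≤-trans (+-mono-<-≤ (n<1+n h) (n≤1+n h)) 2h+2≤n

lemma3p9 : ∀ {c ℓ : Level} (F : FiniteField c ℓ) (r n h : ℕ)
    (a : Fin n → Vect F r) → InjectiveV F a →
    1 ≤ h → h ≤ n → 2 * h < r → r ≤ n →
    IsSLinear F h a →
    ∀ (j : ℕ) → 1 ≤ j → j ≤ h ∸ 1 → IsSLinear F j a
lemma3p9 F r n h a _ _ _ 2h<r r≤n S j _ j≤h∸1 =
  IsSLinear-downward F a (≤⇒≤′ (≤-trans j≤h∸1 (m∸n≤m h 1))) 2h≤n S
  where
  2h≤n : h + h ≤ n
  2h≤n = subst (λ k → h + k ≤ n) (+-identityʳ h) (≤-trans (<⇒≤ 2h<r) r≤n)
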